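{- Let $P$ be a (possibly disjunctive) answer set program and let $M\subseteq\mathrm{at}(P)$ be an interpretation such that $\tau_M\models\mathrm{Comp}(P)$. Let $F = \mathrm{UP}(\mathrm{Copy}(P),\tau_M)\wedge\bigvee_{x\in M\cap\mathrm{LA}(P)}\neg x'$. Then: (1) $F$ is satisfiable if and only if $P^M\wedge\bigwedge_{x\in\mathrm{at}(P)\setminus M}\neg x\wedge\bigwedge_{x\in M\setminus\mathrm{LA}(P)}x\wedge\bigvee_{x\in M\cap\mathrm{LA}(P)}\neg x$ is satisfiable; (2) $F$ is satisfiable if and only if $P^M\wedge\bigwedge_{x\in\mathrm{at}(P)\setminus M}\neg x\wedge\bigvee_{x\in M}\neg x$ is satisfiable.
   Context: A program $P$ is a finite set of rules $r$ of the form $a_1 \vee \dots \vee a_k \leftarrow b_1, \dots, b_m, \mathsf{not}\ c_1, \dots, \mathsf{not}\ c_n$ ($k,m,n \ge 0$) over propositional atoms; $\mathrm{head}(r)=\{a_1,\dots,a_k\}$, $\mathrm{body}(r)^+=\{b_1,\dots,b_m\}$, $\mathrm{body}(r)^-=\{c_1,\dots,c_n\}$, and $\mathrm{body}(r)$ is the set of literals $\{b_1,\dots,b_m,\neg c_1,\dots,\neg c_n\}$. $\mathrm{at}(P)$ is the set of atoms of $P$. An interpretation is $M \subseteq \mathrm{at}(P)$; $\tau_M$ is the assignment on $\mathrm{at}(P)$ with $\tau_M(x)=1$ iff $x\in M$. The reduct $P^M$ is the set of rules $\{\mathrm{head}(r)\leftarrow \mathrm{body}(r)^+ \mid r\in P,\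 \mathrm{body}(r)^-\cap M=\emptyset\}$, regarded as the propositional formula $\bigwedge \big(\bigwedge_{b\in\mathrm{body}(r)^+} b\rightarrow\bigvee_{a\in\mathrm{head}(r)}a\big)$ over those rules. An empty disjunction is false. The Clark completion $\mathrm{Comp}(P)$ is the propositional formula over $\mathrm{at}(P)$ that is the conjunction of: (1) $\neg a$ for each atom $a$ occurring in no rule head; (2) for each rule $r$, $\bigwedge_{\ell\in\mathrm{body}(r)}\ell \rightarrow \bigvee_{x\in\mathrm{head}(r)} x$; (3) for each atom $a$ occurring in some head, with $r_1,\dots,r_k$ all rules having $a$ in the head, $a \rightarrow \bigvee_{i=1}^k\big(\bigwedge_{\ell\in\mathrm{body}(r_i)}\ell \wedge \bigwedge_{x\in\mathrm{head}(r_i)\setminus\{a\}}\neg x\big)$. The positive dependency graph of $P$ has vertex set $\mathrm{at}(P)$ and an edge from $y$ to $x$ whenever some rule $r$ has $x\in\mathrm{body}(r)^+$ and $y\in\mathrm{head}(r)$. A set $L\subseteq \mathrm{at}(P)$ is a loop if for all $x,y\in L$ there is a non-empty directed path from $x$ to $y$ all of whose vertices lie in $L$; $\mathrm{LA}(P)$ (loop atoms) is the set of atoms belonging to some loop. $\mathrm{Copy}(P)$: for each $x\in\mathrm{LA}(P)$ introduce a fresh variable $x'\notin\mathrm{at}(P)$. $\mathrm{Copy}(P)$ is the CNF (set of clauses) given by: (type 1) $x'\rightarrow x$ for every $x\in\mathrm{LA}(P)$; (type 2) for each rule $r=a_1\vee\dots\vee a_k\leftarrow b_1,\dots,b_m,\mathsf{not}\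 c_1,\dots,\mathsf{not}\ c_n$ with $\mathrm{head}(r)\cap\mathrm{LA}(P)\neq\emptyset$, the implication $f(b_1)\wedge\dots\wedge f(b_m)\wedge\neg c_1\wedge\dots\wedge\neg c_n\rightarrow f(a_1)\vee\dots\vee f(a_k)$, where $f(x)=x'$ if $x\in\mathrm{LA}(P)$ and $f(x)=x$ otherwise. Unit propagation: for a CNF $\phi$ (set of clauses) and an assignment $\tau$ to a subset of its variables (with $\tau(\neg x)=1-\tau(x)$), $\mathrm{UP}(\phi,\tau)$ is obtained by repeatedly applying, until no syntactic change occurs: (a) remove every clause containing a literal $\ell$ with $\tau(\ell)=1$; (b) remove from every clause each literal $\ell$ such that $\tau(\ell)=0$ or the unit clause $\{\neg\ell\}$ is present. The unit propagation of the empty formula is empty. -}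

module Defs where

open import Data.Nat using (ℕ; zero; suc; _+_; _≡ᵇ_)
open import Data.Nat.Properties using (_≟_)
open import Data.Bool using (Bool; true; false; not; _∧_; _∨_; if_then_else_)
open import Data.Maybe using (Maybe; just; nothing)
open import Data.List using (List; []; _∷_; _++_; map; filter; foldr; concatMap; length)
open import Data.Bool.ListAction using (any; all)
open import Data.Bool using (T?)
open import Data.List.Membership.Propositional using (_∈_)
open import Data.List.Membership.DecPropositional _≟_ using (_∈?_)
open import Data.List.Relation.Unary.All using (All)
open import Data.Product using (Σ; _×_; _,_; ∃)
open import Relation.Nullary using (Dec; yes; no; does; ¬_)
open import Relation.Binary.PropositionalEquality using (_≡_)

Atom : Set
Atom = ℕ

-- a₁ ∨ … ∨ aₖ ← b₁,…,bₘ, not c₁,…,not cₙ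
record Rule : Set where
  constructor mkRule
  field
    head : List Atom
    pos  : List Atom
    neg  : List Atom
open Rule public

Program : Set
Program = List Rule

atP : Program → List Atom
atP P = concatMap (λ r → head r ++ pos r ++ neg r) P

filterᵇ : {A : Set} → (A → Bool) → List A → List A
filterᵇ p = filter (λ x → T? (p x))

_∈ᵇ_ : Atom → List Atom → Bool
x ∈ᵇ xs = does (x ∈? xs)

-- Propositional formulas over variables x (original) and x' (primed copy).

data Var : Set where
  orig  : Atom → Var
  prime : Atom → Var

data Form : Set where
  var  : Var → Form
  ¬ᶠ_  : Form → Form
  _∧ᶠ_ : Form → Form → Form
  _∨ᶠ_ : Form → Form → Form
  _⇒ᶠ_ : Form → Form → Form
  ⊤ᶠ   : Form
  ⊥ᶠ   : Form

⋀ : List Form → Form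
⋀ = foldr _∧ᶠ_ ⊤ᶠ

⋁ : List Form → Form
⋁ = foldr _∨ᶠ_ ⊥ᶠ

Assignment : Set
Assignment = Var → Bool

eval : Assignment → Form → Bool
eval σ (var v)   = σ v
eval σ (¬ᶠ φ)    = not (eval σ φ)
eval σ (φ ∧ᶠ ψ)  = eval σ φ ∧ eval σ ψ
eval σ (φ ∨ᶠ ψ)  = eval σ φ ∨ eval σ ψ
eval σ (φ ⇒ᶠ ψ)  = not (eval σ φ) ∨ eval σ ψ
eval σ ⊤ᶠ        = true
eval σ ⊥ᶠ        = false

_⊨_ : Assignment → Form → Set
σ ⊨ φ = eval σ φ ≡ true

Satisfiable : Form → Set
Satisfiable φ = ∃ λ σ → σ ⊨ φ

at : Atom → Form
at x = var (orig x)

-- Interpretations: M ⊆ at(P), given as a list.  τ_M as a total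
-- assignment (used for evaluating formulas over at(P)).

τ : List Atom → Assignment
τ M (orig x)  = x ∈ᵇ M
τ M (prime x) = false   -- irrelevant: Comp(P) has no primed variables

bodyF : Rule → Form
bodyF r = ⋀ (map at (pos r)) ∧ᶠ ⋀ (map (λ c → ¬ᶠ at c) (neg r))

headsP : Program → List Atom
headsP P = concatMap head P

Comp : Program → Form
Comp P = ⋀ part1 ∧ᶠ (⋀ part2 ∧ᶠ ⋀ part3)
  where
  part1 = map (λ a → ¬ᶠ at a) (filter (λ a → not? (a ∈? headsP P)) (atP P))
    where
    not? : ∀ {A : Set} → Dec A → Dec (¬ A)
    not? (yes p) = no (λ f → f p)
    not? (no ¬p) = yes ¬p
  part2 = map (λ r → bodyF r ⇒ᶠ ⋁ (map at (head r))) P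
  supp : Atom → Rule → Form
  supp a r = bodyF r ∧ᶠ ⋀ (map (λ x → ¬ᶠ at x) (filter (λ x → not? (x ≟ a)) (head r)))
    where
    not? : ∀ {A : Set} → Dec A → Dec (¬ A)
    not? (yes p) = no (λ f → f p)
    not? (no ¬p) = yes ¬p
  part3 = map (λ a → at a ⇒ᶠ ⋁ (map (supp a) (filter (λ r → a ∈? head r) P)))
              (filter (λ a → a ∈? headsP P) (atP P))

Reduct : Program → List Atom → Form
Reduct P M = ⋀ (map (λ r → ⋀ (map at (pos r)) ⇒ᶠ ⋁ (map at (head r)))
                    (filterᵇ (λ r → all (λ c → not (c ∈ᵇ M)) (neg r)) P))

Edge : Program → Atom → Atom → Set
Edge P y x = ∃ λ r → r ∈ P × x ∈ pos r × y ∈ head r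

data PathIn (P : Program) (L : List Atom) : Atom → Atom → Set where
  one  : ∀ {x y} → x ∈ L → y ∈ L → Edge P x y → PathIn P L x y
  step : ∀ {x z y} → x ∈ L → Edge P x z → PathIn P L z y → PathIn P L x y

Loop : Program → List Atom → Set
Loop P L = All (_∈ atP P) L × (∀ {x y} → x ∈ L → y ∈ L → PathIn P L x y)

InLA : Program → Atom → Set
InLA P x = ∃ λ L → Loop P L × x ∈ L

LADec : Program → Set
LADec P = (x : Atom) → Dec (InLA P x)

data Lit : Set where
  +ₗ : Var → Lit
  -ₗ : Var → Lit

Clause : Set
Clause = List Lit

CNF : Set
CNF = List Clause

negL : Lit → Lit
negL (+ₗ v) = -ₗ v
negL (-ₗ v) = +ₗ v

module _ (P : Program) (la? : LADec P) where

  inLA : Atom → Bool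
  inLA x = does (la? x)

  f : Atom → Var
  f x = if inLA x then prime x else orig x

  LAlist : List Atom
  LAlist = filter la? (atP P)

  Copy : CNF
  Copy = map (λ x → -ₗ (prime x) ∷ +ₗ (orig x) ∷ []) LAlist
      ++ map (λ r → map (λ b → -ₗ (f b)) (pos r)
                     ++ map (λ c → +ₗ (orig c)) (neg r)
                     ++ map (λ a → +ₗ (f a)) (head r))
             (filterᵇ (λ r → any inLA (head r)) P)

PAssignment : Set
PAssignment = Var → Maybe Bool

τp : Program → List Atom → PAssignment
τp P M (orig x)  = if x ∈ᵇ atP P then just (x ∈ᵇ M) else nothing
τp P M (prime x) = nothing

valL : PAssignment → Lit → Maybe Bool
valL t (+ₗ v) = t v
valL t (-ₗ v) with t v
... | just b  = just (not b)
... | nothing = nothing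

isTrue isFalse : PAssignment → Lit → Bool
isTrue t l with valL t l
... | just true = true
... | _         = false
isFalse t l with valL t l
... | just false = true
... | _          = false

eqVar : Var → Var → Bool
eqVar (orig x)  (orig y)  = x ≡ᵇ y
eqVar (prime x) (prime y) = x ≡ᵇ y
eqVar _ _ = false

eqLit : Lit → Lit → Bool
eqLit (+ₗ v) (+ₗ w) = eqVar v w
eqLit (-ₗ v) (-ₗ w) = eqVar v w
eqLit _ _ = false

-- the clause C is (as a set) the unit clause {m}
isUnit : Lit → Clause → Bool
isUnit m []      = false
isUnit m (l ∷ C) = all (eqLit m) (l ∷ C)

unitPresent : CNF → Lit → Bool
unitPresent φ m = any (isUnit m) φ

upStep : PAssignment → CNF → CNF
upStep t φ = map (filter (λ l → T? (keep l))) φa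
  where
  φa : CNF
  φa = filter (λ C → T? (not (any (isTrue t) C))) φ
  keep : Lit → Bool
  keep l = not (isFalse t l) ∧ not (unitPresent φa (negL l))

size : CNF → ℕ
size φ = foldr (λ C n → suc (length C + n)) 0 φ

iter : ℕ → PAssignment → CNF → CNF
iter zero    t φ = φ
iter (suc n) t φ = iter n t (upStep t φ)

-- Every round that changes φ strictly decreases size φ, so after
-- size φ rounds no syntactic change occurs any more.
UP : CNF → PAssignment → CNF
UP φ t = iter (size φ) t φ

litF : Lit → Form
litF (+ₗ v) = var v
litF (-ₗ v) = ¬ᶠ var v

cnfF : CNF → Form
cnfF φ = ⋀ (map (λ C → ⋁ (map litF C)) φ)

module _ (P : Program) (la? : LADec P) (M : List Atom) where

  M∩LA M∖LA at∖M : List Atom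
  M∩LA = filter la? M
  M∖LA = filter (λ x → T? (not (inLA P la? x))) M
  at∖M = filter (λ x → T? (not (x ∈ᵇ M))) (atP P)

  F : Form
  F = cnfF (UP (Copy P la?) (τp P M)) ∧ᶠ ⋁ (map (λ x → ¬ᶠ var (prime x)) M∩LA)

  G₁ : Form
  G₁ = Reduct P M ∧ᶠ (⋀ (map (λ x → ¬ᶠ at x) at∖M)
        ∧ᶠ (⋀ (map at M∖LA) ∧ᶠ ⋁ (map (λ x → ¬ᶠ at x) M∩LA)))

  G₂ : Form
  G₂ = Reduct P M ∧ᶠ (⋀ (map (λ x → ¬ᶠ at x) at∖M) ∧ᶠ ⋁ (map (λ x → ¬ᶠ at x) M))

module Submission where

-- Unit propagation is sound: σ satisfies UP(φ, τ) iff τ, completed by σ, satisfies φ.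
-- For φ = Copy(P) and τ = τ_M this fixes every original atom to its value in M, so reading
-- the copy x′ as the value of the loop atom x turns models of F into models of G₁ and back.
-- G₁ implies G₂ since M ∩ LA(P) ⊆ M. Conversely, let I ⊆ M be a model of P^M missing an atom
-- of M. As M is supported (τ_M ⊨ Comp(P)), every atom of U = M ∖ I heads a rule whose
-- positive body meets U, so U contains a loop L that no positive dependency leaves inside U
-- (the atoms reachable within U from an atom of U reaching the fewest). Then M ∖ L is still a
-- model of P^M, contains M ∖ LA(P) and misses the loop atoms of L: it satisfies G₁.

open import Defs
open import Data.Bool using (Bool; true; false; not; _∧_; _∨_; T?)
import Data.Bool as Bool
open import Data.Bool.ListAction using (any; all)
open import Data.Bool.Properties using (T-≡; ¬-not; ∧-zeroʳ)
open import Data.Empty using (⊥; ⊥-elim)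
open import Data.List using (List; []; _∷_; _++_; map; filter; length)
open import Data.List.Extrema.Nat using (argmin; argmin-all; f[argmin]≤f[xs])
open import Data.List.Membership.Propositional using (_∈_; _∉_; find; lose)
open import Data.List.Membership.Propositional.Properties
  using (∈-filter⁺; ∈-filter⁻; ∈-map⁺; ∈-map⁻; ∈-++⁺ˡ; ∈-++⁺ʳ; ∈-++⁻; ∈-concatMap⁺)
open import Data.List.Relation.Binary.Equality.Propositional using (≋⇒≡)
import Data.List.Relation.Binary.Sublist.Propositional as Sublist
import Data.List.Relation.Binary.Sublist.Propositional.Properties as Sublistₚ
open import Data.List.Relation.Unary.All using (All)
import Data.List.Relation.Unary.All as All
open import Data.List.Relation.Unary.Any using (here; there)
import Data.List.Relation.Unary.Any as Any
open import Data.Maybe using (just; nothing; fromMaybe)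
open import Data.Nat using (zero; suc; _+_; _≤_)
open import Data.Nat.Properties using (_≟_; ≡ᵇ⇒≡; ≤-antisym)
open import Data.List.Membership.DecPropositional _≟_ using (_∈?_)
open import Data.Product using (_×_; _,_; ∃; proj₁; proj₂)
open import Data.Sum using (_⊎_; inj₁; inj₂)
open import Function.Base using (_∘_; id)
open import Function.Bundles using (_⇔_; mk⇔; Equivalence)
open import Function.Construct.Composition using (_⇔-∘_)
open import Function.Properties.Equivalence using (⇔-setoid)
open import Level using (0ℓ)
open import Relation.Binary.Definitions using (Decidable)
open import Relation.Binary.PropositionalEquality
  using (_≡_; _≗_; refl; sym; trans; cong; cong₂; subst)
open import Relation.Nullary using (¬_; Dec; yes; no; contradiction; _×-dec_; _⊎-dec_)
open import Relation.Nullary.Decidable using (map′; dec-true; dec-false)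

open Equivalence using (to; from)

private
  variable
    A : Set
    x : A
    xs : List A
    σ σ′ : Assignment
    p : A → Bool

not≡true⇒≡false : ∀ {b} → not b ≡ true → b ≡ false
not≡true⇒≡false {false} _ = refl

≡false⇒not≡true : ∀ {b} → b ≡ false → not b ≡ true
≡false⇒not≡true refl = refl

true≢false : ∀ {b} → b ≡ true → b ≡ false → ⊥
true≢false refl ()

any≡true⁺ : x ∈ xs → p x ≡ true → any p xs ≡ true
any≡true⁺ {p = p} (here refl) px rewrite px = refl
any≡true⁺ {xs = y ∷ _} {p = p} (there x∈) px with p y
... | true  = refl
... | false = any≡true⁺ x∈ px

any≡true⁻ : any p xs ≡ true → ∃ λ x → x ∈ xs × p x ≡ true
any≡true⁻ {p = p} {xs = y ∷ ys} h with p y in py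
... | true  = y , here refl , py
... | false with any≡true⁻ h
...   | z , z∈ , pz = z , there z∈ , pz

any≡false⁻ : any p xs ≡ false → x ∈ xs → p x ≡ false
any≡false⁻ {p = p} {x = x} h x∈ with p x in px
... | true  = ⊥-elim (true≢false (any≡true⁺ x∈ px) h)
... | false = refl

all≡true⁻ : all p xs ≡ true → x ∈ xs → p x ≡ true
all≡true⁻ {p = p} {xs = y ∷ _} h (here refl) with p y
... | true = refl
all≡true⁻ {p = p} {xs = y ∷ _} h (there x∈) with p y
... | true = all≡true⁻ h x∈

all≡true⁺ : (∀ {x} → x ∈ xs → p x ≡ true) → all p xs ≡ true
all≡true⁺ {xs = []}     h = refl
all≡true⁺ {xs = y ∷ ys} h rewrite h (here refl) = all≡true⁺ (λ x∈ → h (there x∈))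

every-or-counterexample : ∀ (p : A → Bool) b xs →
  (∀ {x} → x ∈ xs → p x ≡ b) ⊎ ∃ λ x → x ∈ xs × p x ≡ not b
every-or-counterexample p b []       = inj₁ (λ ())
every-or-counterexample p b (x ∷ xs) with p x Bool.≟ b | every-or-counterexample p b xs
... | no px≢b | _                    = inj₂ (x , here refl , ¬-not px≢b)
... | yes px≡b | inj₂ (y , y∈ , py)  = inj₂ (y , there y∈ , py)
... | yes px≡b | inj₁ all            = inj₁ λ { (here refl) → px≡b ; (there y∈) → all y∈ }

∈ᵇ⁺ : ∀ {x xs} → x ∈ xs → x ∈ᵇ xs ≡ true
∈ᵇ⁺ {x} {xs} = dec-true (x ∈? xs)

∉ᵇ⁺ : ∀ {x xs} → x ∉ xs → x ∈ᵇ xs ≡ false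
∉ᵇ⁺ {x} {xs} = dec-false (x ∈? xs)

∈ᵇ⁻ : ∀ {x xs} → x ∈ᵇ xs ≡ true → x ∈ xs
∈ᵇ⁻ {x} {xs} h with x ∈? xs
... | yes x∈ = x∈

∉ᵇ⁻ : ∀ {x xs} → x ∈ᵇ xs ≡ false → x ∉ xs
∉ᵇ⁻ h x∈ = true≢false (∈ᵇ⁺ x∈) h

∈-filterᵇ⁺ : x ∈ xs → p x ≡ true → x ∈ filterᵇ p xs
∈-filterᵇ⁺ {p = p} x∈ px = ∈-filter⁺ (λ y → T? (p y)) x∈ (from T-≡ px)

∈-filterᵇ⁻ : x ∈ filterᵇ p xs → x ∈ xs × p x ≡ true
∈-filterᵇ⁻ {p = p} {xs = xs} x∈ with ∈-filter⁻ (λ y → T? (p y)) {xs = xs} x∈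
... | x∈xs , px = x∈xs , to T-≡ px

-- The equation χ ≡ φ ∧ᶠ ψ, always proved by refl, lets Agda unfold a defined formula χ
-- to find its conjuncts; unification through eval cannot.
⊨∧⁺ : ∀ σ χ {φ ψ} → χ ≡ φ ∧ᶠ ψ → σ ⊨ φ → σ ⊨ ψ → σ ⊨ χ
⊨∧⁺ σ _ refl hφ hψ rewrite hφ | hψ = refl

⊨∧⁻ : ∀ σ χ {φ ψ} → χ ≡ φ ∧ᶠ ψ → σ ⊨ χ → σ ⊨ φ × σ ⊨ ψ
⊨∧⁻ σ _ {φ = φ} refl h with eval σ φ
... | true = refl , h

⊨∧₃⁻ : ∀ σ χ {φ ψ ϑ} → χ ≡ φ ∧ᶠ (ψ ∧ᶠ ϑ) → σ ⊨ χ → σ ⊨ φ × σ ⊨ ψ × σ ⊨ ϑ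
⊨∧₃⁻ σ χ {ψ = ψ} {ϑ} refl h with ⊨∧⁻ σ χ refl h
... | hφ , hψϑ = hφ , ⊨∧⁻ σ (ψ ∧ᶠ ϑ) refl hψϑ

⊨⇒⁺ : ∀ σ φ ψ → (σ ⊨ φ → σ ⊨ ψ) → σ ⊨ (φ ⇒ᶠ ψ)
⊨⇒⁺ σ φ ψ h with eval σ φ
... | false = refl
... | true  = h refl

⊨⇒⁻ : ∀ σ φ ψ → σ ⊨ (φ ⇒ᶠ ψ) → σ ⊨ φ → σ ⊨ ψ
⊨⇒⁻ σ φ ψ h hφ rewrite hφ = h

module _ (σ : Assignment) (g : A → Form) where

  ⊨⋀⁺ : ∀ xs → (∀ {x} → x ∈ xs → σ ⊨ g x) → σ ⊨ ⋀ (map g xs)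
  ⊨⋀⁺ []       h = refl
  ⊨⋀⁺ (y ∷ ys) h = ⊨∧⁺ σ (⋀ (map g (y ∷ ys))) refl (h (here refl)) (⊨⋀⁺ ys (λ x∈ → h (there x∈)))

  ⊨⋀⁻ : σ ⊨ ⋀ (map g xs) → x ∈ xs → σ ⊨ g x
  ⊨⋀⁻ {xs = y ∷ ys} h (here refl) = proj₁ (⊨∧⁻ σ (⋀ (map g (y ∷ ys))) refl h)
  ⊨⋀⁻ {xs = y ∷ ys} h (there x∈)  = ⊨⋀⁻ (proj₂ (⊨∧⁻ σ (⋀ (map g (y ∷ ys))) refl h)) x∈

  ⊨⋁⁺ : x ∈ xs → σ ⊨ g x → σ ⊨ ⋁ (map g xs)
  ⊨⋁⁺ (here refl) h rewrite h = refl
  ⊨⋁⁺ {xs = y ∷ _} (there x∈) h with eval σ (g y)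
  ... | true  = refl
  ... | false = ⊨⋁⁺ x∈ h

  ⊨⋁⁻ : σ ⊨ ⋁ (map g xs) → ∃ λ x → x ∈ xs × σ ⊨ g x
  ⊨⋁⁻ {xs = y ∷ _} h with eval σ (g y) in gy
  ... | true  = y , here refl , gy
  ... | false with ⊨⋁⁻ h
  ...   | z , z∈ , gz = z , there z∈ , gz

eval-cong : σ ≗ σ′ → ∀ φ → eval σ φ ≡ eval σ′ φ
eval-cong σ≗σ′ (var v)  = σ≗σ′ v
eval-cong σ≗σ′ (¬ᶠ φ)   = cong not (eval-cong σ≗σ′ φ)
eval-cong σ≗σ′ (φ ∧ᶠ ψ) = cong₂ _∧_ (eval-cong σ≗σ′ φ) (eval-cong σ≗σ′ ψ)
eval-cong σ≗σ′ (φ ∨ᶠ ψ) = cong₂ _∨_ (eval-cong σ≗σ′ φ) (eval-cong σ≗σ′ ψ)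
eval-cong σ≗σ′ (φ ⇒ᶠ ψ) = cong₂ (λ a b → not a ∨ b) (eval-cong σ≗σ′ φ) (eval-cong σ≗σ′ ψ)
eval-cong σ≗σ′ ⊤ᶠ       = refl
eval-cong σ≗σ′ ⊥ᶠ       = refl

_⊨ᶜ_ : Assignment → Clause → Set
σ ⊨ᶜ C = ∃ λ l → l ∈ C × σ ⊨ litF l

_⊨ᶜⁿᶠ_ : Assignment → CNF → Set
σ ⊨ᶜⁿᶠ φ = ∀ {C} → C ∈ φ → σ ⊨ᶜ C

⊨cnfF⇔ : ∀ σ φ → σ ⊨ cnfF φ ⇔ σ ⊨ᶜⁿᶠ φ
⊨cnfF⇔ σ φ = mk⇔
  (λ h {C} C∈ → ⊨⋁⁻ σ litF (⊨⋀⁻ σ clauseF h C∈))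
  (λ h → ⊨⋀⁺ σ clauseF φ (λ C∈ → let l , l∈ , hl = h C∈ in ⊨⋁⁺ σ litF l∈ hl))
  where
  clauseF : Clause → Form
  clauseF C = ⋁ (map litF C)

module _ {A : Set} (g h k : A → Var) (B N H : List A) where

  ruleClause : Clause
  ruleClause = map (-ₗ ∘ g) B ++ map (+ₗ ∘ h) N ++ map (+ₗ ∘ k) H

  ImplicationHolds : Assignment → Set
  ImplicationHolds σ = (∀ {b} → b ∈ B → σ (g b) ≡ true) → (∀ {c} → c ∈ N → σ (h c) ≡ false) →
                       ∃ λ a → a ∈ H × σ (k a) ≡ true

  ⊨ruleClause⇔ : ∀ σ → σ ⊨ᶜ ruleClause ⇔ ImplicationHolds σ
  ⊨ruleClause⇔ σ = mk⇔ implication clause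
    where
    implication : σ ⊨ᶜ ruleClause → ImplicationHolds σ
    implication (l , l∈ , l⊨) B⊨ N⊭ with ∈-++⁻ (map (-ₗ ∘ g) B) l∈
    ... | inj₁ l∈B with ∈-map⁻ (-ₗ ∘ g) l∈B
    ...   | b , b∈ , refl = ⊥-elim (true≢false (B⊨ b∈) (not≡true⇒≡false l⊨))
    implication (l , l∈ , l⊨) B⊨ N⊭ | inj₂ l∈NH with ∈-++⁻ (map (+ₗ ∘ h) N) l∈NH
    ... | inj₁ l∈N with ∈-map⁻ (+ₗ ∘ h) l∈N
    ...   | c , c∈ , refl = ⊥-elim (true≢false l⊨ (N⊭ c∈))
    implication (l , l∈ , l⊨) B⊨ N⊭ | inj₂ l∈NH | inj₂ l∈H with ∈-map⁻ (+ₗ ∘ k) l∈H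
    ...   | a , a∈ , refl = a , a∈ , l⊨

    clause : ImplicationHolds σ → σ ⊨ᶜ ruleClause
    clause impl with every-or-counterexample (σ ∘ g) true B
    ... | inj₂ (b , b∈ , gb) = -ₗ (g b) , ∈-++⁺ˡ (∈-map⁺ (-ₗ ∘ g) b∈) , ≡false⇒not≡true gb
    ... | inj₁ B⊨ with every-or-counterexample (σ ∘ h) false N
    ...   | inj₂ (c , c∈ , hc) = +ₗ (h c) , ∈-++⁺ʳ (map (-ₗ ∘ g) B) (∈-++⁺ˡ (∈-map⁺ (+ₗ ∘ h) c∈)) , hc
    ...   | inj₁ N⊭ with impl B⊨ N⊭
    ...     | a , a∈ , ka =
              +ₗ (k a) , ∈-++⁺ʳ (map (-ₗ ∘ g) B) (∈-++⁺ʳ (map (+ₗ ∘ h) N) (∈-map⁺ (+ₗ ∘ k) a∈)) , ka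

_◃_ : PAssignment → Assignment → Assignment
(t ◃ σ) v = fromMaybe (σ v) (t v)

◃-idem : ∀ t σ → (t ◃ (t ◃ σ)) ≗ (t ◃ σ)
◃-idem t σ v with t v
... | just _  = refl
... | nothing = refl

module _ (t : PAssignment) (σ : Assignment) where

  isTrue⇒◃⊨ : ∀ l → isTrue t l ≡ true → (t ◃ σ) ⊨ litF l
  isTrue⇒◃⊨ (+ₗ v) h with t v
  ... | just true = refl
  isTrue⇒◃⊨ (-ₗ v) h with t v
  ... | just false = refl

  isFalse⇒◃⊭ : ∀ l → isFalse t l ≡ true → eval (t ◃ σ) (litF l) ≡ false
  isFalse⇒◃⊭ (+ₗ v) h with t v
  ... | just false = refl
  isFalse⇒◃⊭ (-ₗ v) h with t v
  ... | just true = refl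

  unassigned⇒◃≡ : ∀ l → isTrue t l ≡ false → isFalse t l ≡ false →
                  eval (t ◃ σ) (litF l) ≡ eval σ (litF l)
  unassigned⇒◃≡ (+ₗ v) ht hf with t v
  ... | just true  = ⊥-elim (true≢false refl ht)
  ... | just false = ⊥-elim (true≢false refl hf)
  ... | nothing    = refl
  unassigned⇒◃≡ (-ₗ v) ht hf with t v
  ... | just true  = ⊥-elim (true≢false refl hf)
  ... | just false = ⊥-elim (true≢false refl ht)
  ... | nothing    = refl

eval-negL : ∀ σ l → eval σ (litF (negL l)) ≡ not (eval σ (litF l))
eval-negL σ (+ₗ v) = refl
eval-negL σ (-ₗ v) with σ v
... | true  = refl
... | false = refl

eqVar⇒≡ : ∀ v w → eqVar v w ≡ true → v ≡ w
eqVar⇒≡ (orig x)  (orig y)  h = cong orig (≡ᵇ⇒≡ x y (from T-≡ h))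
eqVar⇒≡ (prime x) (prime y) h = cong prime (≡ᵇ⇒≡ x y (from T-≡ h))

eqLit⇒≡ : ∀ l m → eqLit l m ≡ true → l ≡ m
eqLit⇒≡ (+ₗ v) (+ₗ w) h = cong +ₗ (eqVar⇒≡ v w h)
eqLit⇒≡ (-ₗ v) (-ₗ w) h = cong -ₗ (eqVar⇒≡ v w h)

⊨unit⇒⊨lit : ∀ {σ m} C → isUnit m C ≡ true → σ ⊨ᶜ C → σ ⊨ litF m
⊨unit⇒⊨lit {m = m} (l ∷ C) unit (l′ , l′∈ , hl′)
  with refl ← eqLit⇒≡ m l′ (all≡true⁻ unit l′∈) = hl′

module _ (t : PAssignment) where

  unsatisfied : CNF → CNF
  unsatisfied φ = filter (λ C → T? (not (any (isTrue t) C))) φ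

  kept : CNF → Lit → Bool
  kept φ l = not (isFalse t l) ∧ not (unitPresent (unsatisfied φ) (negL l))

  module _ (σ : Assignment) where

    ⊨⇒¬isFalse : ∀ l → (t ◃ σ) ⊨ litF l → isFalse t l ≡ false
    ⊨⇒¬isFalse l hl with isFalse t l in eq
    ... | true  = ⊥-elim (true≢false hl (isFalse⇒◃⊭ t σ l eq))
    ... | false = refl

    ⊨⇒negL-not-unit : ∀ {φ l} → (t ◃ σ) ⊨ᶜⁿᶠ φ → (t ◃ σ) ⊨ litF l →
                      unitPresent φ (negL l) ≡ false
    ⊨⇒negL-not-unit {φ} {l} hφ hl with unitPresent φ (negL l) in eq
    ... | false = refl
    ... | true with any≡true⁻ eq
    ...   | C , C∈ , unit = ⊥-elim (true≢false hl (not≡true⇒≡false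
            (trans (sym (eval-negL (t ◃ σ) l)) (⊨unit⇒⊨lit C unit (hφ C∈)))))

    upStep-sound : ∀ φ → σ ⊨ᶜⁿᶠ upStep t φ ⇔ (t ◃ σ) ⊨ᶜⁿᶠ φ
    upStep-sound φ = mk⇔ complete sound
      where
      -- A literal making a clause true under t ◃ σ, when t alone does not, is unassigned by t
      -- and survives both deletion rules.
      sound : (t ◃ σ) ⊨ᶜⁿᶠ φ → σ ⊨ᶜⁿᶠ upStep t φ
      sound hφ C′∈ with ∈-map⁻ (filter (λ l → T? (kept φ l))) C′∈
      ... | C , C∈ , refl with ∈-filter⁻ (λ C → T? (not (any (isTrue t) C))) {xs = φ} C∈
      ... | C∈φ , noTrue with hφ C∈φ
      ... | l , l∈ , hl = l , ∈-filter⁺ (λ l → T? (kept φ l)) l∈ (from T-≡ keep) , σ⊨l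
        where
        ¬isTrue : isTrue t l ≡ false
        ¬isTrue = any≡false⁻ (not≡true⇒≡false (to T-≡ noTrue)) l∈
        ¬isFalse : isFalse t l ≡ false
        ¬isFalse = ⊨⇒¬isFalse l hl
        σ⊨l : σ ⊨ litF l
        σ⊨l = trans (sym (unassigned⇒◃≡ t σ l ¬isTrue ¬isFalse)) hl
        keep : kept φ l ≡ true
        keep = cong₂ (λ a b → not a ∧ not b) ¬isFalse
          (⊨⇒negL-not-unit (λ D∈ → hφ (proj₁ (∈-filter⁻ _ {xs = φ} D∈))) hl)

      complete : σ ⊨ᶜⁿᶠ upStep t φ → (t ◃ σ) ⊨ᶜⁿᶠ φ
      complete hφ′ {C} C∈ with any (isTrue t) C in someTrue
      ... | true with any≡true⁻ someTrue
      ...   | l , l∈ , lTrue = l , l∈ , isTrue⇒◃⊨ t σ l lTrue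
      complete hφ′ {C} C∈ | false
        with hφ′ (∈-map⁺ (filter (λ l → T? (kept φ l)))
                   (∈-filter⁺ (λ C → T? (not (any (isTrue t) C))) C∈ (from T-≡ (cong not someTrue))))
      ... | l , l∈′ , σ⊨l with ∈-filter⁻ (λ l → T? (kept φ l)) {xs = C} l∈′
      ... | l∈ , keep with isFalse t l in lFalse
      ... | true  = ⊥-elim keep
      ... | false = l , l∈ , trans (unassigned⇒◃≡ t σ l (any≡false⁻ someTrue l∈) lFalse) σ⊨l

⊨ᶜⁿᶠ-cong : ∀ {σ σ′} → σ ≗ σ′ → ∀ φ → σ ⊨ᶜⁿᶠ φ ⇔ σ′ ⊨ᶜⁿᶠ φ
⊨ᶜⁿᶠ-cong {σ} {σ′} σ≗σ′ φ = mk⇔ (transport σ≗σ′) (transport (λ v → sym (σ≗σ′ v)))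
  where
  transport : ∀ {τ τ′} → τ ≗ τ′ → τ ⊨ᶜⁿᶠ φ → τ′ ⊨ᶜⁿᶠ φ
  transport τ≗τ′ h C∈ with h C∈
  ... | l , l∈ , hl = l , l∈ , trans (sym (eval-cong τ≗τ′ (litF l))) hl

module _ (t : PAssignment) where
  open import Relation.Binary.Reasoning.Setoid (⇔-setoid 0ℓ)

  iter-sound : ∀ n φ σ → σ ⊨ᶜⁿᶠ iter (suc n) t φ ⇔ (t ◃ σ) ⊨ᶜⁿᶠ φ
  iter-sound zero    φ σ = upStep-sound t σ φ
  iter-sound (suc n) φ σ = begin
    σ ⊨ᶜⁿᶠ iter (suc n) t (upStep t φ)  ≈⟨ iter-sound n (upStep t φ) σ ⟩
    (t ◃ σ) ⊨ᶜⁿᶠ upStep t φ             ≈⟨ upStep-sound t (t ◃ σ) φ ⟩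
    (t ◃ (t ◃ σ)) ⊨ᶜⁿᶠ φ                ≈⟨ ⊨ᶜⁿᶠ-cong (◃-idem t σ) φ ⟩
    (t ◃ σ) ⊨ᶜⁿᶠ φ                      ∎

  UP-sound : ∀ φ σ → σ ⊨ᶜⁿᶠ UP φ t ⇔ (t ◃ σ) ⊨ᶜⁿᶠ φ
  UP-sound []      σ = mk⇔ (λ _ ()) (λ _ ())
  UP-sound (C ∷ φ) σ = iter-sound (length C + size φ) (C ∷ φ) σ

-- Walks and terminal loops in a finite graph

module Walks {A : Set} (_⟶_ : A → A → Set) where

  -- A non-empty walk from x to y whose inner vertices lie in S.
  data Walk (S : List A) : A → A → Set where
    edge : ∀ {x y}   → x ⟶ y → Walk S x y
    via  : ∀ {x z y} → x ⟶ z → z ∈ S → Walk S z y → Walk S x y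

  Walk-mono : ∀ {S S′} → (∀ {z} → z ∈ S → z ∈ S′) → ∀ {x y} → Walk S x y → Walk S′ x y
  Walk-mono S⊆S′ (edge e)     = edge e
  Walk-mono S⊆S′ (via e z∈ w) = via e (S⊆S′ z∈) (Walk-mono S⊆S′ w)

  Walk-trans : ∀ {S x y z} → Walk S x y → y ∈ S → Walk S y z → Walk S x z
  Walk-trans (edge e)     y∈ w′ = via e y∈ w′
  Walk-trans (via e z∈ w) y∈ w′ = via e z∈ (Walk-trans w y∈ w′)

  -- Cutting a walk at its first and last visit of z.
  Walk-∷⁻ : ∀ {z S x y} → Walk (z ∷ S) x y → Walk S x y ⊎ (Walk S x z × Walk S z y)
  Walk-∷⁻ (edge e) = inj₁ (edge e)
  Walk-∷⁻ (via e (here refl) w) with Walk-∷⁻ w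
  ... | inj₁ w′        = inj₂ (edge e , w′)
  ... | inj₂ (_ , w′)  = inj₂ (edge e , w′)
  Walk-∷⁻ (via e (there z∈) w) with Walk-∷⁻ w
  ... | inj₁ w′        = inj₁ (via e z∈ w′)
  ... | inj₂ (w₁ , w₂) = inj₂ (via e z∈ w₁ , w₂)

  Walk-∷⁺ : ∀ {z S x y} → Walk S x y ⊎ (Walk S x z × Walk S z y) → Walk (z ∷ S) x y
  Walk-∷⁺ (inj₁ w)        = Walk-mono there w
  Walk-∷⁺ (inj₂ (w₁ , w₂)) = Walk-trans (Walk-mono there w₁) (here refl) (Walk-mono there w₂)

  record TerminalLoop (U : List A) : Set where
    field
      L                  : List A
      L⊆U                : ∀ {x} → x ∈ L → x ∈ U
      nonempty           : ∃ λ x → x ∈ L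
      strongly-connected : ∀ {x y} → x ∈ L → y ∈ L → Walk L x y
      closed             : ∀ {x y} → x ∈ L → y ∈ U → x ⟶ y → y ∈ L

  module _ (_⟶?_ : Decidable _⟶_) where

    Walk? : ∀ S x y → Dec (Walk S x y)
    Walk? []      x y = map′ edge (λ { (edge e) → e }) (x ⟶? y)
    Walk? (z ∷ S) x y = map′ Walk-∷⁺ Walk-∷⁻ (Walk? S x y ⊎-dec (Walk? S x z ×-dec Walk? S z y))

    -- The set of vertices reachable inside U from a vertex whose reachable set is smallest.
    terminalLoop : ∀ U → (∀ {x} → x ∈ U → ∃ λ y → y ∈ U × x ⟶ y) → ∀ {a₀} → a₀ ∈ U → TerminalLoop U
    terminalLoop U successor {a₀} a₀∈U = record
      { L = reach a ; L⊆U = reach⊆U ; nonempty = nonempty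
      ; strongly-connected = strongly-connected ; closed = closed }
      where
      reach : A → List A
      reach b = filter (Walk? U b) U

      reach⊆U : ∀ {b x} → x ∈ reach b → x ∈ U
      reach⊆U {b} x∈ = proj₁ (∈-filter⁻ (Walk? U b) {xs = U} x∈)

      reach-walk : ∀ {b x} → x ∈ reach b → Walk U b x
      reach-walk {b} x∈ = proj₂ (∈-filter⁻ (Walk? U b) {xs = U} x∈)

      a : A
      a = argmin (length ∘ reach) a₀ U

      a∈U : a ∈ U
      a∈U = argmin-all (length ∘ reach) a₀∈U (All.tabulate id)

      a-minimal : ∀ {b} → b ∈ U → length (reach a) ≤ length (reach b)
      a-minimal = All.lookup (f[argmin]≤f[xs] {f = length ∘ reach} a₀ U)

      nonempty : ∃ λ x → x ∈ reach a
      nonempty with successor a∈U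
      ... | y , y∈U , e = y , ∈-filter⁺ (Walk? U a) y∈U (edge e)

      closed : ∀ {x y} → x ∈ reach a → y ∈ U → x ⟶ y → y ∈ reach a
      closed x∈ y∈U e = ∈-filter⁺ (Walk? U a) y∈U (Walk-trans (reach-walk x∈) (reach⊆U x∈) (edge e))

      reach-stable : ∀ {b} → b ∈ reach a → reach b ≡ reach a
      reach-stable {b} b∈ = ≋⇒≡ (Sublistₚ.to-≋ (≤-antisym (Sublistₚ.length-mono-≤ reach-b⊆reach-a)
                                                       (a-minimal (reach⊆U b∈)))
                                            reach-b⊆reach-a)
        where
        reach-b⊆reach-a : reach b Sublist.⊆ reach a
        reach-b⊆reach-a = Sublistₚ.filter⁺ (Walk? U b) (Walk? U a)
          (λ { refl w → Walk-trans (reach-walk b∈) (reach⊆U b∈) w }) (Sublist.⊆-refl {x = U})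

      restrict : ∀ {x y} → x ∈ reach a → Walk U x y → Walk (reach a) x y
      restrict x∈ (edge e)       = edge e
      restrict x∈ (via e z∈U w) = via e z∈ (restrict z∈ w)
        where z∈ = closed x∈ z∈U e

      strongly-connected : ∀ {x y} → x ∈ reach a → y ∈ reach a → Walk (reach a) x y
      strongly-connected {x} x∈ y∈ = restrict x∈ (reach-walk (subst (_ ∈_) (sym (reach-stable x∈)) y∈))

module _ {P : Program} {r : Rule} (r∈P : r ∈ P) where

  rule-atom∈at : ∀ {x} → x ∈ head r ++ pos r ++ neg r → x ∈ atP P
  rule-atom∈at x∈ = ∈-concatMap⁺ (λ r → head r ++ pos r ++ neg r) (Any.map (λ { refl → x∈ }) r∈P)

  head∈at : ∀ {x} → x ∈ head r → x ∈ atP P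
  head∈at x∈ = rule-atom∈at (∈-++⁺ˡ x∈)

  pos∈at : ∀ {x} → x ∈ pos r → x ∈ atP P
  pos∈at x∈ = rule-atom∈at (∈-++⁺ʳ (head r) (∈-++⁺ˡ x∈))

  neg∈at : ∀ {x} → x ∈ neg r → x ∈ atP P
  neg∈at x∈ = rule-atom∈at (∈-++⁺ʳ (head r) (∈-++⁺ʳ (pos r) x∈))

BodyHolds : List Atom → Rule → Set
BodyHolds M r = (∀ {b} → b ∈ pos r → b ∈ M) × (∀ {c} → c ∈ neg r → c ∉ M)

τ⊨bodyF⇔ : ∀ M r → τ M ⊨ bodyF r ⇔ BodyHolds M r
τ⊨bodyF⇔ M r = mk⇔ holds satisfied
  where
  holds : τ M ⊨ bodyF r → BodyHolds M r
  holds h with ⊨∧⁻ (τ M) (bodyF r) refl h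
  ... | h⁺ , h⁻ = (λ b∈ → ∈ᵇ⁻ (⊨⋀⁻ (τ M) at h⁺ b∈))
                , (λ c∈ → ∉ᵇ⁻ (not≡true⇒≡false (⊨⋀⁻ (τ M) (λ c → ¬ᶠ at c) h⁻ c∈)))

  satisfied : BodyHolds M r → τ M ⊨ bodyF r
  satisfied (pos⊆M , neg∩M≡∅) = ⊨∧⁺ (τ M) (bodyF r) refl
    (⊨⋀⁺ (τ M) at (pos r) (λ b∈ → ∈ᵇ⁺ (pos⊆M b∈)))
    (⊨⋀⁺ (τ M) (λ c → ¬ᶠ at c) (neg r) (λ c∈ → ≡false⇒not≡true (∉ᵇ⁺ (neg∩M≡∅ c∈))))

module Completion (P : Program) (M : List Atom) (M⊆at : All (_∈ atP P) M)
                  (hC : τ M ⊨ Comp P) where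

  rule-holds : ∀ {r} → r ∈ P → BodyHolds M r → ∃ λ h → h ∈ head r × h ∈ M
  rule-holds {r} r∈ body with ⊨∧₃⁻ (τ M) (Comp P) refl hC
  ... | _ , rules , _
    with ⊨⋁⁻ (τ M) at (⊨⇒⁻ (τ M) (bodyF r) (⋁ (map at (head r)))
                          (⊨⋀⁻ (τ M) _ rules r∈) (from (τ⊨bodyF⇔ M r) body))
  ... | h , h∈ , hM = h , h∈ , ∈ᵇ⁻ hM

  supported : ∀ {x} → x ∈ M → ∃ λ r → r ∈ P × x ∈ head r × BodyHolds M r
                                      × (∀ {h} → h ∈ head r → h ∈ M → h ≡ x)
  supported {x} x∈M with ⊨∧₃⁻ (τ M) (Comp P) refl hC | x ∈? headsP P
  ... | undefined , _ , _ | no x∉heads = ⊥-elim (true≢false (∈ᵇ⁺ x∈M)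
          (not≡true⇒≡false (⊨⋀⁻ (τ M) _ undefined (∈-filter⁺ _ (All.lookup M⊆at x∈M) x∉heads))))
  ... | _ , _ , supports | yes x∈heads
    with ⊨⋁⁻ (τ M) _ (⊨⇒⁻ (τ M) (at x) (⋁ (map _ (filter (λ r → x ∈? head r) P)))
           (⊨⋀⁻ (τ M) _ supports (∈-filter⁺ _ (All.lookup M⊆at x∈M) x∈heads)) (∈ᵇ⁺ x∈M))
  ... | r , r∈ , support
    with ∈-filter⁻ (λ r → x ∈? head r) {xs = P} r∈
       | ⊨∧⁻ (τ M) (bodyF r ∧ᶠ ⋀ (map (λ y → ¬ᶠ at y) (filter _ (head r)))) refl support
  ... | r∈P , x∈head | body , others-false =
    r , r∈P , x∈head , to (τ⊨bodyF⇔ M r) body , unique-head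
    where
    unique-head : ∀ {h} → h ∈ head r → h ∈ M → h ≡ x
    unique-head {h} h∈ hM with h ≟ x
    ... | yes h≡x = h≡x
    ... | no  h≢x = ⊥-elim (true≢false (∈ᵇ⁺ hM)
                      (not≡true⇒≡false (⊨⋀⁻ (τ M) _ others-false (∈-filter⁺ _ h∈ h≢x))))

Interpretation : Set
Interpretation = Atom → Bool

doubled : Interpretation → Assignment
doubled I (orig x)  = I x
doubled I (prime x) = I x

ReductModel : Program → List Atom → Interpretation → Set
ReductModel P M I = ∀ {r} → r ∈ P → (∀ {c} → c ∈ neg r → c ∉ M) →
                    (∀ {b} → b ∈ pos r → I b ≡ true) → ∃ λ h → h ∈ head r × I h ≡ true

⊨Reduct⇔ : ∀ P M σ → σ ⊨ Reduct P M ⇔ ReductModel P M (σ ∘ orig)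
⊨Reduct⇔ P M σ = mk⇔ model satisfied
  where
  ruleF : Rule → Form
  ruleF r = ⋀ (map at (pos r)) ⇒ᶠ ⋁ (map at (head r))

  negFree : Rule → Bool
  negFree r = all (λ c → not (c ∈ᵇ M)) (neg r)

  model : σ ⊨ Reduct P M → ReductModel P M (σ ∘ orig)
  model h {r} r∈ neg∩M≡∅ pos⊆I =
    ⊨⋁⁻ σ at (⊨⇒⁻ σ (⋀ (map at (pos r))) (⋁ (map at (head r)))
                  (⊨⋀⁻ σ ruleF h r∈reduct) (⊨⋀⁺ σ at (pos r) pos⊆I))
    where
    r∈reduct : r ∈ filterᵇ negFree P
    r∈reduct = ∈-filterᵇ⁺ r∈ (all≡true⁺ (λ c∈ → ≡false⇒not≡true (∉ᵇ⁺ (neg∩M≡∅ c∈))))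

  satisfied : ReductModel P M (σ ∘ orig) → σ ⊨ Reduct P M
  satisfied I⊨ = ⊨⋀⁺ σ ruleF (filterᵇ negFree P) λ {r} r∈ →
    let r∈P , free = ∈-filterᵇ⁻ r∈ in
    ⊨⇒⁺ σ (⋀ (map at (pos r))) (⋁ (map at (head r))) λ pos⊨ →
      let h , h∈ , h⊨ = I⊨ r∈P (λ c∈ → ∉ᵇ⁻ (not≡true⇒≡false (all≡true⁻ free c∈)))
                                (⊨⋀⁻ σ at pos⊨)
      in ⊨⋁⁺ σ at h∈ h⊨

⊨⋁¬⇔ : ∀ σ xs → σ ⊨ ⋁ (map (λ x → ¬ᶠ at x) xs) ⇔ ∃ λ x → x ∈ xs × σ (orig x) ≡ false
⊨⋁¬⇔ σ xs = mk⇔ witness satisfied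
  where
  witness : σ ⊨ ⋁ (map (λ x → ¬ᶠ at x) xs) → ∃ λ x → x ∈ xs × σ (orig x) ≡ false
  witness h with ⊨⋁⁻ σ (λ x → ¬ᶠ at x) h
  ... | x , x∈ , x⊭ = x , x∈ , not≡true⇒≡false x⊭

  satisfied : (∃ λ x → x ∈ xs × σ (orig x) ≡ false) → σ ⊨ ⋁ (map (λ x → ¬ᶠ at x) xs)
  satisfied (x , x∈ , x⊭) = ⊨⋁⁺ σ (λ x → ¬ᶠ at x) x∈ (≡false⇒not≡true x⊭)

module FormulaSemantics (P : Program) (la? : LADec P) (M : List Atom) where

  inLA≡false⁻ : ∀ {x} → inLA P la? x ≡ false → ¬ InLA P x
  inLA≡false⁻ {x} h with la? x
  ... | no ¬la = ¬la

  f-LA : ∀ {x} → InLA P x → f P la? x ≡ prime x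
  f-LA {x} la with la? x
  ... | yes _  = refl
  ... | no ¬la = contradiction la ¬la

  f-nonLA : ∀ {x} → ¬ InLA P x → f P la? x ≡ orig x
  f-nonLA {x} ¬la with la? x
  ... | yes la = contradiction la ¬la
  ... | no _   = refl

  record SubModel (I : Interpretation) : Set where
    field
      reduct      : ReductModel P M I
      outside-M   : ∀ {x} → x ∈ atP P → x ∉ M → I x ≡ false

  submodel⊆M : ∀ {I} → SubModel I → ∀ {x} → x ∈ atP P → I x ≡ true → x ∈ M
  submodel⊆M sub {x} x∈ Ix with x ∈? M
  ... | yes x∈M = x∈M
  ... | no  x∉M = ⊥-elim (true≢false Ix (SubModel.outside-M sub x∈ x∉M))

  record G₁-Model (I : Interpretation) : Set where
    field
      submodel    : SubModel I
      non-loop    : ∀ {x} → x ∈ M → ¬ InLA P x → I x ≡ true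
      loop-false  : ∃ λ x → x ∈ M × InLA P x × I x ≡ false

  record G₂-Model (I : Interpretation) : Set where
    field
      submodel    : SubModel I
      some-false  : ∃ λ x → x ∈ M × I x ≡ false

  private
    outsideF nonLoopF loopFalseF : Form
    outsideF   = ⋀ (map (λ x → ¬ᶠ at x) (at∖M P la? M))
    nonLoopF   = ⋀ (map at (M∖LA P la? M))
    loopFalseF = ⋁ (map (λ x → ¬ᶠ at x) (M∩LA P la? M))

    ⊨outside⇔ : ∀ σ → σ ⊨ outsideF ⇔ (∀ {x} → x ∈ atP P → x ∉ M → σ (orig x) ≡ false)
    ⊨outside⇔ σ = mk⇔ model satisfied
      where
      model : σ ⊨ outsideF → ∀ {x} → x ∈ atP P → x ∉ M → σ (orig x) ≡ false
      model h x∈ x∉M = not≡true⇒≡false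
        (⊨⋀⁻ σ (λ x → ¬ᶠ at x) h (∈-filterᵇ⁺ x∈ (≡false⇒not≡true (∉ᵇ⁺ x∉M))))

      satisfied : (∀ {x} → x ∈ atP P → x ∉ M → σ (orig x) ≡ false) → σ ⊨ outsideF
      satisfied h = ⊨⋀⁺ σ (λ x → ¬ᶠ at x) (at∖M P la? M) λ x∈ →
        let x∈at , x∉M = ∈-filterᵇ⁻ x∈ in
        ≡false⇒not≡true (h x∈at (∉ᵇ⁻ (not≡true⇒≡false x∉M)))

    ⊨nonLoop⇔ : ∀ σ → σ ⊨ nonLoopF ⇔ (∀ {x} → x ∈ M → ¬ InLA P x → σ (orig x) ≡ true)
    ⊨nonLoop⇔ σ = mk⇔ model satisfied
      where
      model : σ ⊨ nonLoopF → ∀ {x} → x ∈ M → ¬ InLA P x → σ (orig x) ≡ true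
      model h {x} x∈ ¬la = ⊨⋀⁻ σ at h (∈-filterᵇ⁺ x∈ (≡false⇒not≡true (dec-false (la? x) ¬la)))

      satisfied : (∀ {x} → x ∈ M → ¬ InLA P x → σ (orig x) ≡ true) → σ ⊨ nonLoopF
      satisfied h = ⊨⋀⁺ σ at (M∖LA P la? M) λ x∈ →
        let x∈M , ¬la = ∈-filterᵇ⁻ x∈ in h x∈M (inLA≡false⁻ (not≡true⇒≡false ¬la))

    ⊨loopFalse⇔ : ∀ σ → σ ⊨ loopFalseF ⇔ ∃ λ x → x ∈ M × InLA P x × σ (orig x) ≡ false
    ⊨loopFalse⇔ σ = mk⇔ witness satisfied
      where
      witness : σ ⊨ loopFalseF → ∃ λ x → x ∈ M × InLA P x × σ (orig x) ≡ false
      witness h with to (⊨⋁¬⇔ σ (M∩LA P la? M)) h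
      ... | x , x∈ , x⊭ with ∈-filter⁻ la? {xs = M} x∈
      ...   | x∈M , la = x , x∈M , la , x⊭

      satisfied : (∃ λ x → x ∈ M × InLA P x × σ (orig x) ≡ false) → σ ⊨ loopFalseF
      satisfied (x , x∈M , la , x⊭) = from (⊨⋁¬⇔ σ (M∩LA P la? M)) (x , ∈-filter⁺ la? x∈M la , x⊭)

  ⊨G₁⇔ : ∀ σ → σ ⊨ G₁ P la? M ⇔ G₁-Model (σ ∘ orig)
  ⊨G₁⇔ σ = mk⇔ model satisfied
    where
    model : σ ⊨ G₁ P la? M → G₁-Model (σ ∘ orig)
    model h with ⊨∧⁻ σ (G₁ P la? M) refl h
    ... | hR , rest with ⊨∧₃⁻ σ (outsideF ∧ᶠ (nonLoopF ∧ᶠ loopFalseF)) refl rest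
    ... | hO , hN , hL = record
      { submodel   = record { reduct = to (⊨Reduct⇔ P M σ) hR ; outside-M = to (⊨outside⇔ σ) hO }
      ; non-loop   = to (⊨nonLoop⇔ σ) hN
      ; loop-false = to (⊨loopFalse⇔ σ) hL }

    satisfied : G₁-Model (σ ∘ orig) → σ ⊨ G₁ P la? M
    satisfied I = ⊨∧⁺ σ (G₁ P la? M) refl (from (⊨Reduct⇔ P M σ) (SubModel.reduct (submodel I)))
      (⊨∧⁺ σ (outsideF ∧ᶠ (nonLoopF ∧ᶠ loopFalseF)) refl
        (from (⊨outside⇔ σ) (SubModel.outside-M (submodel I)))
      (⊨∧⁺ σ (nonLoopF ∧ᶠ loopFalseF) refl (from (⊨nonLoop⇔ σ) (non-loop I))
        (from (⊨loopFalse⇔ σ) (loop-false I))))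
      where open G₁-Model

  ⊨G₂⇔ : ∀ σ → σ ⊨ G₂ P la? M ⇔ G₂-Model (σ ∘ orig)
  ⊨G₂⇔ σ = mk⇔ model satisfied
    where
    someFalseF : Form
    someFalseF = ⋁ (map (λ x → ¬ᶠ at x) M)

    model : σ ⊨ G₂ P la? M → G₂-Model (σ ∘ orig)
    model h with ⊨∧₃⁻ σ (G₂ P la? M) refl h
    ... | hR , hO , hS = record
      { submodel   = record { reduct = to (⊨Reduct⇔ P M σ) hR ; outside-M = to (⊨outside⇔ σ) hO }
      ; some-false = to (⊨⋁¬⇔ σ M) hS }

    satisfied : G₂-Model (σ ∘ orig) → σ ⊨ G₂ P la? M
    satisfied I = ⊨∧⁺ σ (G₂ P la? M) refl (from (⊨Reduct⇔ P M σ) (SubModel.reduct (submodel I)))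
      (⊨∧⁺ σ (outsideF ∧ᶠ someFalseF) refl (from (⊨outside⇔ σ) (SubModel.outside-M (submodel I)))
        (from (⊨⋁¬⇔ σ M) (some-false I)))
      where open G₂-Model

  record CopyModel (ρ : Assignment) : Set where
    field
      copy⇒orig : ∀ {x} → x ∈ atP P → InLA P x → ρ (prime x) ≡ true → ρ (orig x) ≡ true
      rule      : ∀ {r} → r ∈ P → any (inLA P la?) (head r) ≡ true →
                  ImplicationHolds (f P la?) orig (f P la?) (pos r) (neg r) (head r) ρ

  ⊨Copy⇔ : ∀ ρ → ρ ⊨ᶜⁿᶠ Copy P la? ⇔ CopyModel ρ
  ⊨Copy⇔ ρ = mk⇔ model satisfied
    where
    typeOne : Atom → Clause
    typeOne x = -ₗ (prime x) ∷ +ₗ (orig x) ∷ []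

    typeTwo : Rule → Clause
    typeTwo r = ruleClause (f P la?) orig (f P la?) (pos r) (neg r) (head r)

    model : ρ ⊨ᶜⁿᶠ Copy P la? → CopyModel ρ
    model h = record
      { copy⇒orig = copy⇒orig
      ; rule      = λ {r} r∈ anyLA → to (⊨ruleClause⇔ (f P la?) orig (f P la?) (pos r) (neg r) (head r) ρ)
                      (h (∈-++⁺ʳ (map typeOne (LAlist P la?)) (∈-map⁺ typeTwo (∈-filterᵇ⁺ r∈ anyLA)))) }
      where
      copy⇒orig : ∀ {x} → x ∈ atP P → InLA P x → ρ (prime x) ≡ true → ρ (orig x) ≡ true
      copy⇒orig x∈ la ρx′ with h (∈-++⁺ˡ (∈-map⁺ typeOne (∈-filter⁺ la? x∈ la)))
      ... | _ , here refl , ¬ρx′        = ⊥-elim (true≢false ρx′ (not≡true⇒≡false ¬ρx′))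
      ... | _ , there (here refl) , ρx = ρx

    satisfied : CopyModel ρ → ρ ⊨ᶜⁿᶠ Copy P la?
    satisfied copy C∈ with ∈-++⁻ (map typeOne (LAlist P la?)) C∈
    ... | inj₁ C∈₁ with ∈-map⁻ typeOne C∈₁
    ...   | x , x∈ , refl with ∈-filter⁻ la? {xs = atP P} x∈ | ρ (prime x) in ρx′
    ...     | x∈at , la | true  = +ₗ (orig x) , there (here refl) , CopyModel.copy⇒orig copy x∈at la ρx′
    ...     | _         | false = -ₗ (prime x) , here refl , ≡false⇒not≡true ρx′
    satisfied copy C∈ | inj₂ C∈₂ with ∈-map⁻ typeTwo C∈₂
    ...   | r , r∈ , refl with ∈-filterᵇ⁻ r∈
    ...     | r∈P , anyLA = from (⊨ruleClause⇔ (f P la?) orig (f P la?) (pos r) (neg r) (head r) ρ)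
                                 (CopyModel.rule copy r∈P anyLA)

  τp◃-orig : ∀ σ {x} → x ∈ atP P → (τp P M ◃ σ) (orig x) ≡ x ∈ᵇ M
  τp◃-orig σ x∈ rewrite ∈ᵇ⁺ x∈ = refl

  ⊨F⇔ : ∀ σ → σ ⊨ F P la? M ⇔ (CopyModel (τp P M ◃ σ) × ∃ λ x → x ∈ M × InLA P x × σ (prime x) ≡ false)
  ⊨F⇔ σ = mk⇔ model satisfied
    where
    copyModel⇔ : σ ⊨ cnfF (UP (Copy P la?) (τp P M)) ⇔ CopyModel (τp P M ◃ σ)
    copyModel⇔ = ⊨Copy⇔ (τp P M ◃ σ)
             ⇔-∘ (UP-sound (τp P M) (Copy P la?) σ ⇔-∘ ⊨cnfF⇔ σ (UP (Copy P la?) (τp P M)))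

    model : σ ⊨ F P la? M → CopyModel (τp P M ◃ σ) × ∃ λ x → x ∈ M × InLA P x × σ (prime x) ≡ false
    model h with ⊨∧⁻ σ (F P la? M) refl h
    ... | hU , hD with ⊨⋁⁻ σ (λ x → ¬ᶠ var (prime x)) hD
    ...   | x , x∈ , x′⊭ with ∈-filter⁻ la? {xs = M} x∈
    ...     | x∈M , la = to copyModel⇔ hU , x , x∈M , la , not≡true⇒≡false x′⊭

    satisfied : CopyModel (τp P M ◃ σ) × (∃ λ x → x ∈ M × InLA P x × σ (prime x) ≡ false) → σ ⊨ F P la? M
    satisfied (copy , x , x∈M , la , x′⊭) = ⊨∧⁺ σ (F P la? M) refl (from copyModel⇔ copy)
      (⊨⋁⁺ σ (λ x → ¬ᶠ var (prime x)) (∈-filter⁺ la? x∈M la) (≡false⇒not≡true x′⊭))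

Edge? : ∀ P → Decidable (Edge P)
Edge? P y x = map′ find (λ (r , r∈ , x∈ , y∈) → lose r∈ (x∈ , y∈))
                   (Any.any? (λ r → (x ∈? pos r) ×-dec (y ∈? head r)) P)

open Walks using (Walk; edge; via)

walk⇒PathIn : ∀ {P L x y} → x ∈ L → y ∈ L → Walk (Edge P) L x y → PathIn P L x y
walk⇒PathIn x∈ y∈ (edge e)     = one x∈ y∈ e
walk⇒PathIn x∈ y∈ (via e z∈ w) = step x∈ e (walk⇒PathIn z∈ y∈ w)

module Implications (P : Program) (M : List Atom) (M⊆at : All (_∈ atP P) M)
                    (la? : LADec P) (hC : τ M ⊨ Comp P) where

  open FormulaSemantics P la? M
  open Completion P M M⊆at hC

  M⊆atP : ∀ {x} → x ∈ M → x ∈ atP P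
  M⊆atP = All.lookup M⊆at

  F⇒G₁ : Satisfiable (F P la? M) → Satisfiable (G₁ P la? M)
  F⇒G₁ (σ , h) with to (⊨F⇔ σ) h
  ... | copy , x₀ , x₀∈M , x₀∈LA , x₀′⊭ = doubled I , from (⊨G₁⇔ (doubled I)) model
    where
    open CopyModel copy
    ρ : Assignment
    ρ = τp P M ◃ σ

    I : Interpretation
    I x = ρ (f P la? x)

    I-LA : ∀ {x} → InLA P x → I x ≡ σ (prime x)
    I-LA la = cong ρ (f-LA la)

    I-nonLA : ∀ {x} → x ∈ atP P → ¬ InLA P x → I x ≡ x ∈ᵇ M
    I-nonLA x∈ ¬la = trans (cong ρ (f-nonLA ¬la)) (τp◃-orig σ x∈)

    I⊆M : ∀ {x} → x ∈ atP P → I x ≡ true → x ∈ M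
    I⊆M {x} x∈ Ix = by-cases (la? x)
      where
      by-cases : Dec (InLA P x) → x ∈ M
      by-cases (yes la) = ∈ᵇ⁻ (trans (sym (τp◃-orig σ x∈)) (copy⇒orig x∈ la (trans (sym (I-LA la)) Ix)))
      by-cases (no ¬la) = ∈ᵇ⁻ (trans (sym (I-nonLA x∈ ¬la)) Ix)

    reduct : ReductModel P M I
    reduct {r} r∈ neg∩M≡∅ pos⊆I with any (inLA P la?) (head r) in anyLA
    ... | true  = rule r∈ anyLA pos⊆I (λ c∈ → trans (τp◃-orig σ (neg∈at r∈ c∈)) (∉ᵇ⁺ (neg∩M≡∅ c∈)))
    ... | false with rule-holds r∈ ((λ b∈ → I⊆M (pos∈at r∈ b∈) (pos⊆I b∈)) , neg∩M≡∅)
    ...   | h , h∈ , h∈M = h , h∈ , trans (I-nonLA (head∈at r∈ h∈) (inLA≡false⁻ (any≡false⁻ anyLA h∈)))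
                                          (∈ᵇ⁺ h∈M)

    outside-M : ∀ {x} → x ∈ atP P → x ∉ M → I x ≡ false
    outside-M {x} x∈ x∉M with I x in Ix
    ... | true  = contradiction (I⊆M x∈ Ix) x∉M
    ... | false = refl

    model : G₁-Model I
    model = record
      { submodel   = record { reduct = reduct ; outside-M = outside-M }
      ; non-loop   = λ x∈M ¬la → trans (I-nonLA (M⊆atP x∈M) ¬la) (∈ᵇ⁺ x∈M)
      ; loop-false = x₀ , x₀∈M , x₀∈LA , trans (I-LA x₀∈LA) x₀′⊭ }

  G₁⇒F : Satisfiable (G₁ P la? M) → Satisfiable (F P la? M)
  G₁⇒F (θ , h) with to (⊨G₁⇔ θ) h
  ... | model with G₁-Model.loop-false model
  ...   | x₀ , x₀∈M , x₀∈LA , x₀⊭ = doubled I , from (⊨F⇔ (doubled I)) (copy , x₀ , x₀∈M , x₀∈LA , x₀⊭)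
    where
    open G₁-Model model using (submodel; non-loop)
    open SubModel submodel
    I : Interpretation
    I = θ ∘ orig

    ρ : Assignment
    ρ = τp P M ◃ doubled I

    I≡M-off-LA : ∀ {x} → x ∈ atP P → ¬ InLA P x → I x ≡ x ∈ᵇ M
    I≡M-off-LA {x} x∈ ¬la with x ∈? M
    ... | yes x∈M = non-loop x∈M ¬la
    ... | no  x∉M = outside-M x∈ x∉M

    ρf≡I : ∀ {x} → x ∈ atP P → ρ (f P la? x) ≡ I x
    ρf≡I {x} x∈ with la? x
    ... | yes _  = refl
    ... | no ¬la = trans (τp◃-orig (doubled I) x∈) (sym (I≡M-off-LA x∈ ¬la))

    copy : CopyModel ρ
    copy = record
      { copy⇒orig = λ {x} x∈ _ Ix → trans (τp◃-orig (doubled I) x∈) (∈ᵇ⁺ (submodel⊆M submodel x∈ Ix))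
      ; rule = λ r∈ _ pos⊨ neg⊭ →
          let h , h∈ , Ih = reduct r∈
                (λ c∈ → ∉ᵇ⁻ (trans (sym (τp◃-orig (doubled I) (neg∈at r∈ c∈))) (neg⊭ c∈)))
                (λ b∈ → trans (sym (ρf≡I (pos∈at r∈ b∈))) (pos⊨ b∈))
          in h , h∈ , trans (ρf≡I (head∈at r∈ h∈)) Ih }

  G₁⇒G₂ : Satisfiable (G₁ P la? M) → Satisfiable (G₂ P la? M)
  G₁⇒G₂ (θ , h) with to (⊨G₁⇔ θ) h
  ... | model with G₁-Model.loop-false model
  ...   | x , x∈M , _ , x⊭ = θ , from (⊨G₂⇔ θ) (record { submodel = G₁-Model.submodel model
                                                    ; some-false = x , x∈M , x⊭ })

  module Unfounded (I : Interpretation) (sub : SubModel I) where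
    open SubModel sub

    U : List Atom
    U = filterᵇ (not ∘ I) M

    U⁺ : ∀ {x} → x ∈ M → I x ≡ false → x ∈ U
    U⁺ x∈M Ix = ∈-filterᵇ⁺ x∈M (≡false⇒not≡true Ix)

    U⁻ : ∀ {x} → x ∈ U → x ∈ M × I x ≡ false
    U⁻ x∈U = let x∈M , ¬Ix = ∈-filterᵇ⁻ x∈U in x∈M , not≡true⇒≡false ¬Ix

    -- The rule supporting x has a body atom that is false in I, else I would satisfy its head x.
    U-successor : ∀ {x} → x ∈ U → ∃ λ y → y ∈ U × Edge P x y
    U-successor x∈U with U⁻ x∈U
    ... | x∈M , Ix with supported x∈M
    ...   | r , r∈ , x∈head , (pos⊆M , neg∩M≡∅) , unique-head with every-or-counterexample I true (pos r)
    ...     | inj₂ (b , b∈ , Ib) = b , U⁺ (pos⊆M b∈) Ib , r , r∈ , b∈ , x∈head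
    ...     | inj₁ pos⊆I with reduct r∈ neg∩M≡∅ pos⊆I
    ...       | h , h∈ , Ih with refl ← unique-head h∈ (submodel⊆M sub (head∈at r∈ h∈) Ih) =
                ⊥-elim (true≢false Ih Ix)

    module WithoutLoop (loop : Walks.TerminalLoop (Edge P) U) where
      open Walks.TerminalLoop loop

      L⊆M : ∀ {x} → x ∈ L → x ∈ M
      L⊆M x∈L = proj₁ (U⁻ (L⊆U x∈L))

      L⊆LA : ∀ {x} → x ∈ L → InLA P x
      L⊆LA x∈L = L , (All.tabulate (M⊆atP ∘ L⊆M) , λ y∈ z∈ → walk⇒PathIn y∈ z∈ (strongly-connected y∈ z∈))
                   , x∈L

      I′ : Interpretation
      I′ x = x ∈ᵇ M ∧ not (x ∈ᵇ L)

      I′⁺ : ∀ {x} → x ∈ M → x ∉ L → I′ x ≡ true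
      I′⁺ x∈M x∉L = cong₂ _∧_ (∈ᵇ⁺ x∈M) (cong not (∉ᵇ⁺ x∉L))

      I′⁻ : ∀ {x} → I′ x ≡ true → x ∈ M × x ∉ L
      I′⁻ {x} I′x with x ∈ᵇ M in x∈M | x ∈ᵇ L in x∈L
      ... | true  | false = ∈ᵇ⁻ x∈M , ∉ᵇ⁻ x∈L
      ... | true  | true  = ⊥-elim (true≢false I′x refl)
      ... | false | _     = ⊥-elim (true≢false I′x refl)

      -- A rule whose body holds in I′ has a head in M; it can only lie in L if some body atom
      -- outside I is reached from L, contradicting the closedness of L.
      reduct′ : ReductModel P M I′
      reduct′ {r} r∈ neg∩M≡∅ pos⊆I′ with rule-holds r∈ ((λ b∈ → proj₁ (I′⁻ (pos⊆I′ b∈))) , neg∩M≡∅)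
      ... | h , h∈ , h∈M with h ∈? L
      ...   | no h∉L = h , h∈ , I′⁺ h∈M h∉L
      ...   | yes h∈L with every-or-counterexample I true (pos r)
      ...     | inj₂ (b , b∈ , Ib) =
                let b∈M , b∉L = I′⁻ (pos⊆I′ b∈) in
                contradiction (closed h∈L (U⁺ b∈M Ib) (r , r∈ , b∈ , h∈)) b∉L
      ...     | inj₁ pos⊆I with reduct r∈ neg∩M≡∅ pos⊆I
      ...       | h′ , h′∈ , Ih′ with h′ ∈? L
      ...         | no h′∉L  = h′ , h′∈ , I′⁺ (submodel⊆M sub (head∈at r∈ h′∈) Ih′) h′∉L
      ...         | yes h′∈L = ⊥-elim (true≢false Ih′ (proj₂ (U⁻ (L⊆U h′∈L))))

      model′ : G₁-Model I′
      model′ = record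
        { submodel   = record { reduct = reduct′
                              ; outside-M = λ {x} _ x∉M → cong (_∧ not (x ∈ᵇ L)) (∉ᵇ⁺ x∉M) }
        ; non-loop   = λ x∈M ¬la → I′⁺ x∈M (¬la ∘ L⊆LA)
        ; loop-false = let x , x∈L = nonempty in
                       x , L⊆M x∈L , L⊆LA x∈L , trans (cong (λ b → x ∈ᵇ M ∧ not b) (∈ᵇ⁺ x∈L)) (∧-zeroʳ _) }

  G₂⇒G₁ : Satisfiable (G₂ P la? M) → Satisfiable (G₁ P la? M)
  G₂⇒G₁ (θ , h) with to (⊨G₂⇔ θ) h
  ... | model with G₂-Model.some-false model
  ...   | x₀ , x₀∈M , x₀⊭ = doubled I′ , from (⊨G₁⇔ (doubled I′)) model′
    where
    open Unfounded (θ ∘ orig) (G₂-Model.submodel model)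
    open WithoutLoop (Walks.terminalLoop (Edge P) (Edge? P) U U-successor (U⁺ x₀∈M x₀⊭))

lemma2 : (P : Program) (M : List Atom) (M⊆at : All (_∈ atP P) M) (la? : LADec P)
    → τ M ⊨ Comp P
    → (Satisfiable (F P la? M) ⇔ Satisfiable (G₁ P la? M))
      × (Satisfiable (F P la? M) ⇔ Satisfiable (G₂ P la? M))
lemma2 P M M⊆at la? hC =
  mk⇔ F⇒G₁ G₁⇒F , mk⇔ (G₁⇒G₂ ∘ F⇒G₁) (G₁⇒F ∘ G₂⇒G₁)
  where open Implications P M M⊆at la? hC
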